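{- Let $X$ be a finite connected simplicial complex with vertices $v_1,\dots,v_m$. The maps $d_{\varepsilon\to\varepsilon'}$ are well defined (independent of the representing cycle), and the map $d=\bigoplus_j d^j$ on $\ddot{C}^*(X)$ is a differential, i.e. $d^{j+1}\circ d^j=0$ for all $j$, which preserves the bigrading (dimension, weight).
   Context: $\mathbb{F}$ is the field with two elements; $C(X)$ is the simplicial chain complex of $X$ over $\mathbb{F}$. A colouring $\varepsilon\in\mathbb{Z}_2^m$ colours $v_i$ black if $\varepsilon(i)=1$ and white otherwise; $|\varepsilon|$ is the number of black vertices; the weight $w_\varepsilon(\sigma)$ is the number of white vertices of $\sigma$. The horizontal differential $\partial_h^\varepsilon$ sends a simplex $\sigma$ to the sum of its faces $\sigma\setminus\{v\}$ over black vertices $v\in\sigma$; $\mathrm{H}^h(X,\varepsilon)$ is the homology of $(C(X),\partial_h^\varepsilon)$, bigraded by (dimension, weight). For colourings $\varepsilon,\varepsilon'$ differing only in the $i$-th entry, with $\varepsilon(i)=0$, $\varepsilon'(i)=1$, define $d_{\varepsilon\to\varepsilon'}:\mathrm{H}^h(X,\varepsilon)\to\mathrm{H}^h(X,\varepsilon')$ on a class represented by a $\partial_h^\varepsilon$-cycle $x$ (a sum of simplices) by $[x]\mapsto[x']$, where $x'$ is obtained from $x$ by deleting the simplices containing $v_i$ (i.e. keeping only the part of $x$ whose weight is unchanged; equivalently, the map induced on associated graded objects by the filtered identity $C(X,\varepsilon)\to C(X,\varepsilon')$). Set $\ddot{C}^j(X)=\bigoplus_{|\varepsilon|=j}\mathrm{H}^h(X,\varepsilon)$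 for $0\le j\le m$ and let $d^j:\ddot{C}^j(X)\to\ddot{C}^{j+1}(X)$ be the sum of all maps $d_{\varepsilon\to\varepsilon'}$ with $|\varepsilon|=j$. -}

module Defs where

open import Data.Nat using (ℕ; zero; suc; _∸_)
open import Data.Bool using (Bool; true; false; _∧_; _xor_; not; if_then_else_)
open import Data.Fin using (Fin; zero; suc)
open import Data.Fin.Subset using (Subset; ⁅_⁆; _∪_; _∩_; _⊆_; ∁; ∣_∣; ⊥; Nonempty)
open import Data.Vec using (lookup; _[_]≔_)
open import Data.Product using (Σ; ∃; _×_; _,_)
open import Relation.Binary.PropositionalEquality using (_≡_)

record SimplicialComplex (m : ℕ) : Set where
  field
    face          : Subset m → Bool
    noEmpty       : face ⊥ ≡ false
    downClosed    : ∀ {σ τ} → face σ ≡ true → τ ⊆ σ → Nonempty τ → face τ ≡ true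
    vertices      : ∀ i → face ⁅ i ⁆ ≡ true
open SimplicialComplex public

data Path {m : ℕ} (X : SimplicialComplex m) : Fin m → Fin m → Set where
  here : ∀ {i} → Path X i i
  step : ∀ {i j k} → face X (⁅ i ⁆ ∪ ⁅ j ⁆) ≡ true → Path X j k → Path X i k

Connected : ∀ {m} → SimplicialComplex m → Set
Connected {m} X = ∀ (i j : Fin m) → Path X i j

-- F₂-chains: a chain is a function Subset m → Bool (coefficient of each
-- simplex), supported on the simplices of X.

Chain : ℕ → Set
Chain m = Subset m → Bool

IsChain : ∀ {m} → SimplicialComplex m → Chain m → Set
IsChain X c = ∀ σ → c σ ≡ true → face X σ ≡ true

zeroC : ∀ {m} → Chain m
zeroC σ = false

_+C_ : ∀ {m} → Chain m → Chain m → Chain m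
(c +C d) σ = c σ xor d σ

⊕ : ∀ {m} → (Fin m → Bool) → Bool
⊕ {zero}  f = false
⊕ {suc m} f = f zero xor ⊕ (λ i → f (suc i))

-- Colourings: ε : Subset m, vertex v_i is black iff lookup ε i ≡ true.
Colouring : ℕ → Set
Colouring m = Subset m

∂h : ∀ {m} → SimplicialComplex m → Colouring m → Chain m → Chain m
∂h X ε c τ = face X τ ∧ ⊕ (λ i → not (lookup τ i) ∧ (lookup ε i ∧ c (τ ∪ ⁅ i ⁆)))

IsCycle : ∀ {m} → SimplicialComplex m → Colouring m → Chain m → Set
IsCycle X ε x = ∀ σ → ∂h X ε x σ ≡ false

Homologous : ∀ {m} → SimplicialComplex m → Colouring m → Chain m → Chain m → Set
Homologous X ε x y = Σ (Chain _) λ z → IsChain X z × (∀ σ → (x +C y) σ ≡ ∂h X ε z σ)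

dim : ∀ {m} → Subset m → ℕ
dim σ = ∣ σ ∣ ∸ 1

weight : ∀ {m} → Colouring m → Subset m → ℕ
weight ε σ = ∣ σ ∩ ∁ ε ∣

Homogeneous : ∀ {m} → Colouring m → ℕ → ℕ → Chain m → Set
Homogeneous ε p w x = ∀ σ → x σ ≡ true → (dim σ ≡ p) × (weight ε σ ≡ w)

-- delete the simplices containing v_i (representative-level d_{ε→ε'})
del : ∀ {m} → Fin m → Chain m → Chain m
del i x σ = not (lookup σ i) ∧ x σ

blacken : ∀ {m} → Colouring m → Fin m → Colouring m
blacken ε i = ε [ i ]≔ true

whiten : ∀ {m} → Colouring m → Fin m → Colouring m
whiten ε i = ε [ i ]≔ false

-- d on representatives: given a family x_ε of representatives (one for each
-- colouring; for d^j only those with |ε| = j matter), the ε'-component of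
-- d x is  Σ_{ε → ε'} d_{ε→ε'}[x_ε] = Σ_{i black in ε'} del i (x_{ε' with v_i white}).
dRep : ∀ {m} → (Colouring m → Chain m) → (Colouring m → Chain m)
dRep x ε' σ = ⊕ (λ i → lookup ε' i ∧ del i (x (whiten ε' i)) σ)

-- an element of C̈^j(X), given by cycle representatives for each |ε| = j
IsCddRep : ∀ {m} → SimplicialComplex m → ℕ → (Colouring m → Chain m) → Set
IsCddRep X j x = ∀ ε → ∣ ε ∣ ≡ j → IsChain X (x ε) × IsCycle X ε (x ε)

-- Deleting the simplices through a vertex v_i is a chain map from
-- (C(X), ∂ʰ^ε) to (C(X), ∂ʰ^ε′) when v_i turns from white to black:
-- the faces of σ ∌ v_i across black vertices never contain v_i, and the
-- only face of σ ∋ v_i avoiding v_i is taken across v_i, which is white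
-- for ε. Hence cycles, boundaries and the bigrading are preserved. For
-- d ∘ d, the term of the double sum through v_i then v_k equals the one
-- through v_k then v_i, so over F₂ the two cancel and d ∘ d vanishes
-- already on representatives.
module Submission where

open import Defs
open import Algebra.Bundles using (CommutativeMonoid; CommutativeRing)
open import Data.Nat using (ℕ; zero; suc)
open import Data.Nat.Properties using (suc-injective)
open import Data.Bool using (Bool; true; false; _∧_; _∨_; _xor_; not)
open import Data.Bool.Properties
  using (∧-zeroʳ; ∧-distribˡ-xor; ∨-zeroʳ; ∨-identityʳ; xor-identityʳ; xor-same;
         ∧-commutativeMonoid; xor-∧-commutativeRing)
open import Data.Fin using (Fin; zero; suc; _≟_)
open import Data.Fin.Subset using (Subset; ⁅_⁆; _∪_; _∩_; ∁; ∣_∣)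
open import Data.Vec using (_∷_; lookup; _[_]≔_)
open import Data.Vec.Properties
  using (lookup-zipWith; lookup-replicate; lookup∘update; lookup∘update′;
         []≔-idempotent; []≔-commutes; []≔-lookup)
open import Data.Product using (Σ; _×_; _,_; proj₁; proj₂)
open import Function using (_∘_)
open import Relation.Binary.PropositionalEquality
  using (_≡_; _≢_; refl; sym; trans; cong; cong₂; subst; module ≡-Reasoning)
open import Relation.Nullary using (yes; no; contradiction)

open import Algebra.Properties.CommutativeSemigroup
  (CommutativeMonoid.commutativeSemigroup ∧-commutativeMonoid) using (x∙yz≈y∙xz)
open import Algebra.Properties.Semiring.Sum
  (CommutativeRing.semiring xor-∧-commutativeRing)
  using (sum; sum-cong-≗; sum-replicate-zero; ∑-distrib-+; ∑-comm; *-distribˡ-sum)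

open ≡-Reasoning

∧-pull-third : ∀ a b c d → a ∧ (b ∧ (c ∧ d)) ≡ c ∧ (a ∧ (b ∧ d))
∧-pull-third a b c d = trans (cong (a ∧_) (x∙yz≈y∙xz b c d)) (x∙yz≈y∙xz a c (b ∧ d))

∧-swap-pairs : ∀ a b c d e → a ∧ (b ∧ (c ∧ (d ∧ e))) ≡ c ∧ (d ∧ (a ∧ (b ∧ e)))
∧-swap-pairs a b c d e =
  trans (∧-pull-third a b c (d ∧ e)) (cong (c ∧_) (∧-pull-third a b d e))

⊕≡sum : ∀ {m} (f : Fin m → Bool) → ⊕ f ≡ sum f
⊕≡sum {zero}  f = refl
⊕≡sum {suc m} f = cong (f zero xor_) (⊕≡sum (f ∘ suc))

⊕-cong : ∀ {m} {f g : Fin m → Bool} → (∀ i → f i ≡ g i) → ⊕ f ≡ ⊕ g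
⊕-cong {f = f} {g} f≗g = trans (⊕≡sum f) (trans (sum-cong-≗ f≗g) (sym (⊕≡sum g)))

⊕-zero : ∀ {m} {f : Fin m → Bool} → (∀ i → f i ≡ false) → ⊕ f ≡ false
⊕-zero {m} {f} f≗0 = trans (⊕≡sum f) (trans (sum-cong-≗ f≗0) (sum-replicate-zero m))

⊕-distrib-xor : ∀ {m} (f g : Fin m → Bool) → ⊕ (λ i → f i xor g i) ≡ ⊕ f xor ⊕ g
⊕-distrib-xor f g = begin
  ⊕ (λ i → f i xor g i)  ≡⟨ ⊕≡sum (λ i → f i xor g i) ⟩
  sum (λ i → f i xor g i) ≡⟨ ∑-distrib-+ f g ⟩
  sum f xor sum g        ≡⟨ sym (cong₂ _xor_ (⊕≡sum f) (⊕≡sum g)) ⟩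
  ⊕ f xor ⊕ g            ∎

∧-distribˡ-⊕ : ∀ {m} b (f : Fin m → Bool) → b ∧ ⊕ f ≡ ⊕ (λ i → b ∧ f i)
∧-distribˡ-⊕ b f = begin
  b ∧ ⊕ f             ≡⟨ cong (b ∧_) (⊕≡sum f) ⟩
  b ∧ sum f           ≡⟨ *-distribˡ-sum b f ⟩
  sum (λ i → b ∧ f i) ≡⟨ sym (⊕≡sum (λ i → b ∧ f i)) ⟩
  ⊕ (λ i → b ∧ f i)   ∎

⊕⊕≡sum-sum : ∀ {m n} (f : Fin m → Fin n → Bool) →
  ⊕ (λ i → ⊕ (f i)) ≡ sum (λ i → sum (f i))
⊕⊕≡sum-sum f = trans (⊕≡sum (λ i → ⊕ (f i))) (sum-cong-≗ (λ i → ⊕≡sum (f i)))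

⊕-comm : ∀ {m n} (f : Fin m → Fin n → Bool) →
  ⊕ (λ i → ⊕ (λ k → f i k)) ≡ ⊕ (λ k → ⊕ (λ i → f i k))
⊕-comm f = trans (⊕⊕≡sum-sum f) (trans (∑-comm f) (sym (⊕⊕≡sum-sum (λ k i → f i k))))

⊕≡true⇒term≡true : ∀ {m} (f : Fin m → Bool) → ⊕ f ≡ true → Σ (Fin m) λ i → f i ≡ true
⊕≡true⇒term≡true {suc m} f ⊕f≡true with f zero in f₀≡true
... | true  = zero , f₀≡true
... | false = let i , fᵢ≡true = ⊕≡true⇒term≡true (f ∘ suc) ⊕f≡true in suc i , fᵢ≡true

-- Over F₂ the off-diagonal terms cancel in pairs.
⊕⊕-symmetric-hollow : ∀ {m} (f : Fin m → Fin m → Bool) →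
  (∀ i → f i i ≡ false) → (∀ i k → f i k ≡ f k i) → ⊕ (λ i → ⊕ (f i)) ≡ false
⊕⊕-symmetric-hollow {zero}  f hollow symmetric = refl
⊕⊕-symmetric-hollow {suc m} f hollow symmetric = begin
  (f zero zero xor row) xor ⊕ (λ i → f (suc i) zero xor ⊕ (f (suc i) ∘ suc))
    ≡⟨ cong₂ (λ d rest → (d xor row) xor rest) (hollow zero)
             (⊕-distrib-xor (λ i → f (suc i) zero) (λ i → ⊕ (f (suc i) ∘ suc))) ⟩
  row xor (⊕ (λ i → f (suc i) zero) xor ⊕ (λ i → ⊕ (f (suc i) ∘ suc)))
    ≡⟨ cong₂ (λ column rest → row xor (column xor rest))
             (⊕-cong (λ i → symmetric (suc i) zero))
             (⊕⊕-symmetric-hollow (λ i k → f (suc i) (suc k))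
               (hollow ∘ suc) (λ i k → symmetric (suc i) (suc k))) ⟩
  row xor (row xor false)
    ≡⟨ trans (cong (row xor_) (xor-identityʳ row)) (xor-same row) ⟩
  false ∎
  where
  row : Bool
  row = ⊕ (f zero ∘ suc)

lookup-⁅⁆-self : ∀ {n} (i : Fin n) → lookup ⁅ i ⁆ i ≡ true
lookup-⁅⁆-self zero    = refl
lookup-⁅⁆-self (suc i) = lookup-⁅⁆-self i

lookup-⁅⁆-other : ∀ {n} {i k : Fin n} → i ≢ k → lookup ⁅ k ⁆ i ≡ false
lookup-⁅⁆-other {i = zero}  {zero}  i≢k = contradiction refl i≢k
lookup-⁅⁆-other {i = zero}  {suc k} i≢k = refl
lookup-⁅⁆-other {i = suc i} {zero}  i≢k = lookup-replicate i false
lookup-⁅⁆-other {i = suc i} {suc k} i≢k = lookup-⁅⁆-other (i≢k ∘ cong suc)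

lookup-∪⁅⁆-self : ∀ {n} (τ : Subset n) i → lookup (τ ∪ ⁅ i ⁆) i ≡ true
lookup-∪⁅⁆-self τ i = begin
  lookup (τ ∪ ⁅ i ⁆) i         ≡⟨ lookup-zipWith _∨_ i τ ⁅ i ⁆ ⟩
  lookup τ i ∨ lookup ⁅ i ⁆ i  ≡⟨ cong (lookup τ i ∨_) (lookup-⁅⁆-self i) ⟩
  lookup τ i ∨ true            ≡⟨ ∨-zeroʳ (lookup τ i) ⟩
  true                         ∎

lookup-∪⁅⁆-other : ∀ {n} (τ : Subset n) {i k} → i ≢ k → lookup (τ ∪ ⁅ k ⁆) i ≡ lookup τ i
lookup-∪⁅⁆-other τ {i} {k} i≢k = begin
  lookup (τ ∪ ⁅ k ⁆) i         ≡⟨ lookup-zipWith _∨_ i τ ⁅ k ⁆ ⟩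
  lookup τ i ∨ lookup ⁅ k ⁆ i  ≡⟨ cong (lookup τ i ∨_) (lookup-⁅⁆-other i≢k) ⟩
  lookup τ i ∨ false           ≡⟨ ∨-identityʳ (lookup τ i) ⟩
  lookup τ i                   ∎

∣ε∣≡suc∣whiten∣ : ∀ {n} (ε : Colouring n) i → lookup ε i ≡ true → ∣ ε ∣ ≡ suc ∣ whiten ε i ∣
∣ε∣≡suc∣whiten∣ (true  ∷ ε) zero    _   = refl
∣ε∣≡suc∣whiten∣ (true  ∷ ε) (suc i) εᵢ = cong suc (∣ε∣≡suc∣whiten∣ ε i εᵢ)
∣ε∣≡suc∣whiten∣ (false ∷ ε) (suc i) εᵢ = ∣ε∣≡suc∣whiten∣ ε i εᵢ

white-part-update : ∀ {n} (σ ε : Subset n) i b → lookup σ i ≡ false →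
  σ ∩ ∁ (ε [ i ]≔ b) ≡ σ ∩ ∁ ε
white-part-update (false ∷ σ) (_ ∷ ε) zero    b _   = refl
white-part-update (s ∷ σ)     (e ∷ ε) (suc i) b σᵢ =
  cong ((s ∧ not e) ∷_) (white-part-update σ ε i b σᵢ)

blacken-whiten : ∀ {m} (ε : Colouring m) i → lookup ε i ≡ true → blacken (whiten ε i) i ≡ ε
blacken-whiten ε i εᵢ = begin
  ε [ i ]≔ false [ i ]≔ true  ≡⟨ []≔-idempotent ε i ⟩
  ε [ i ]≔ true               ≡⟨ cong (ε [ i ]≔_) (sym εᵢ) ⟩
  ε [ i ]≔ lookup ε i         ≡⟨ []≔-lookup ε i ⟩
  ε                           ∎

∂h-zeroC : ∀ {m} (X : SimplicialComplex m) ε τ → ∂h X ε zeroC τ ≡ false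
∂h-zeroC X ε τ = trans
  (cong (face X τ ∧_) (⊕-zero (λ k →
    trans (cong (not (lookup τ k) ∧_) (∧-zeroʳ (lookup ε k))) (∧-zeroʳ _))))
  (∧-zeroʳ (face X τ))

∂h-⊕ : ∀ {m n} (X : SimplicialComplex m) ε (c : Fin n → Chain m) τ →
  ∂h X ε (λ σ → ⊕ (λ j → c j σ)) τ ≡ ⊕ (λ j → ∂h X ε (c j) τ)
∂h-⊕ {m} X ε c τ = begin
  face X τ ∧ ⊕ (λ k → viaCoface k (⊕ (λ j → c j (τ ∪ ⁅ k ⁆))))
    ≡⟨ cong (face X τ ∧_) (⊕-cong λ k → scalars-inside k) ⟩
  face X τ ∧ ⊕ (λ k → ⊕ (λ j → viaCoface k (c j (τ ∪ ⁅ k ⁆))))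
    ≡⟨ cong (face X τ ∧_) (⊕-comm (λ k j → viaCoface k (c j (τ ∪ ⁅ k ⁆)))) ⟩
  face X τ ∧ ⊕ (λ j → ⊕ (λ k → viaCoface k (c j (τ ∪ ⁅ k ⁆))))
    ≡⟨ ∧-distribˡ-⊕ (face X τ) (λ j → ⊕ (λ k → viaCoface k (c j (τ ∪ ⁅ k ⁆)))) ⟩
  ⊕ (λ j → ∂h X ε (c j) τ) ∎
  where
  viaCoface : Fin m → Bool → Bool
  viaCoface k b = not (lookup τ k) ∧ (lookup ε k ∧ b)
  scalars-inside : ∀ k → viaCoface k (⊕ (λ j → c j (τ ∪ ⁅ k ⁆)))
                       ≡ ⊕ (λ j → viaCoface k (c j (τ ∪ ⁅ k ⁆)))
  scalars-inside k =
    trans (cong (not (lookup τ k) ∧_) (∧-distribˡ-⊕ (lookup ε k) (λ j → c j (τ ∪ ⁅ k ⁆))))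
          (∧-distribˡ-⊕ (not (lookup τ k)) (λ j → lookup ε k ∧ c j (τ ∪ ⁅ k ⁆)))

∂h-del : ∀ {m} (X : SimplicialComplex m) ε i → lookup ε i ≡ false → ∀ x τ →
  ∂h X (blacken ε i) (del i x) τ ≡ del i (∂h X ε x) τ
∂h-del {m} X ε i εᵢ x τ = begin
  face X τ ∧ ⊕ (λ k → not (lookup τ k) ∧ (lookup (blacken ε i) k ∧ del i x (τ ∪ ⁅ k ⁆)))
    ≡⟨ cong (face X τ ∧_) (⊕-cong summand) ⟩
  face X τ ∧ ⊕ (λ k → not (lookup τ i) ∧ ∂x k)
    ≡⟨ cong (face X τ ∧_) (sym (∧-distribˡ-⊕ (not (lookup τ i)) ∂x)) ⟩
  face X τ ∧ (not (lookup τ i) ∧ ⊕ ∂x)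
    ≡⟨ x∙yz≈y∙xz (face X τ) (not (lookup τ i)) (⊕ ∂x) ⟩
  del i (∂h X ε x) τ ∎
  where
  ∂x : Fin m → Bool
  ∂x k = not (lookup τ k) ∧ (lookup ε k ∧ x (τ ∪ ⁅ k ⁆))
  summand : ∀ k → not (lookup τ k) ∧ (lookup (blacken ε i) k ∧ del i x (τ ∪ ⁅ k ⁆))
                ≡ not (lookup τ i) ∧ ∂x k
  summand k with k ≟ i
  ... | yes refl
    rewrite lookup∘update k ε true | lookup-∪⁅⁆-self τ k | εᵢ
    = trans (∧-zeroʳ τ∌k) (sym (trans (cong (τ∌k ∧_) (∧-zeroʳ τ∌k)) (∧-zeroʳ τ∌k)))
    where
    τ∌k : Bool
    τ∌k = not (lookup τ k)
  ... | no k≢i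
    rewrite lookup∘update′ k≢i ε true | lookup-∪⁅⁆-other τ (k≢i ∘ sym)
    = ∧-pull-third (not (lookup τ k)) (lookup ε k) (not (lookup τ i)) _

vanishing⇒homologous-zeroC : ∀ {m} (X : SimplicialComplex m) ε {c : Chain m} →
  (∀ σ → c σ ≡ false) → Homologous X ε c zeroC
vanishing⇒homologous-zeroC X ε c≡0 =
  zeroC , (λ σ ()) , λ σ → trans (cong (_xor false) (c≡0 σ)) (sym (∂h-zeroC X ε σ))

del-isChain : ∀ {m} (X : SimplicialComplex m) i {z} → IsChain X z → IsChain X (del i z)
del-isChain X i z-chain σ zσ with lookup σ i
... | false = z-chain σ zσ

del-isCycle : ∀ {m} (X : SimplicialComplex m) ε i → lookup ε i ≡ false → ∀ x →
  IsCycle X ε x → IsCycle X (blacken ε i) (del i x)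
del-isCycle X ε i εᵢ x x-cycle τ = begin
  ∂h X (blacken ε i) (del i x) τ  ≡⟨ ∂h-del X ε i εᵢ x τ ⟩
  not (lookup τ i) ∧ ∂h X ε x τ   ≡⟨ cong (not (lookup τ i) ∧_) (x-cycle τ) ⟩
  not (lookup τ i) ∧ false        ≡⟨ ∧-zeroʳ (not (lookup τ i)) ⟩
  false                           ∎

del-homologous : ∀ {m} (X : SimplicialComplex m) ε i → lookup ε i ≡ false → ∀ {x y} →
  Homologous X ε x y → Homologous X (blacken ε i) (del i x) (del i y)
del-homologous X ε i εᵢ {x} {y} (z , z-chain , x+y≡∂z) =
  del i z , del-isChain X i z-chain , λ σ → begin
    del i x σ xor del i y σ         ≡⟨ sym (∧-distribˡ-xor (not (lookup σ i)) (x σ) (y σ)) ⟩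
    del i (x +C y) σ                ≡⟨ cong (not (lookup σ i) ∧_) (x+y≡∂z σ) ⟩
    del i (∂h X ε z) σ              ≡⟨ sym (∂h-del X ε i εᵢ z σ) ⟩
    ∂h X (blacken ε i) (del i z) σ  ∎

del-homogeneous : ∀ {m} (ε : Colouring m) i p w x →
  Homogeneous ε p w x → Homogeneous (blacken ε i) p w (del i x)
del-homogeneous ε i p w x x-homogeneous σ del-xσ with lookup σ i in σᵢ
... | false = let dim≡p , weight≡w = x-homogeneous σ del-xσ in
  dim≡p , trans (cong ∣_∣ (white-part-update σ ε i true σᵢ)) weight≡w

dRep-isCddRep : ∀ {m} (X : SimplicialComplex m) j x → IsCddRep X j x → IsCddRep X (suc j) (dRep x)
dRep-isCddRep {m} X j x x-rep ε ∣ε∣≡1+j = chain , cycle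
  where
  summand : Fin m → Chain m
  summand i σ = lookup ε i ∧ del i (x (whiten ε i)) σ
  rep : ∀ i → lookup ε i ≡ true →
    IsChain X (x (whiten ε i)) × IsCycle X (whiten ε i) (x (whiten ε i))
  rep i εᵢ = x-rep (whiten ε i) (suc-injective (trans (sym (∣ε∣≡suc∣whiten∣ ε i εᵢ)) ∣ε∣≡1+j))
  chain : IsChain X (dRep x ε)
  chain σ dxσ with ⊕≡true⇒term≡true (λ i → summand i σ) dxσ
  ... | i , summandᵢ with lookup ε i in εᵢ | lookup σ i
  ...   | true | false = proj₁ (rep i εᵢ) σ summandᵢ
  summand-cycle : ∀ i τ → ∂h X ε (summand i) τ ≡ false
  summand-cycle i τ with lookup ε i in εᵢ
  ... | false = ∂h-zeroC X ε τ
  ... | true  = subst (λ ε′ → ∂h X ε′ (del i (x (whiten ε i))) τ ≡ false)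
      (blacken-whiten ε i εᵢ)
      (del-isCycle X (whiten ε i) i (lookup∘update i ε false) (x (whiten ε i)) (proj₂ (rep i εᵢ)) τ)
  cycle : IsCycle X ε (dRep x ε)
  cycle τ = trans (∂h-⊕ X ε summand τ) (⊕-zero (λ i → summand-cycle i τ))

dRep-dRep≡false : ∀ {m} (x : Colouring m → Chain m) ε σ → dRep (dRep x) ε σ ≡ false
dRep-dRep≡false {m} x ε σ = trans (⊕-cong pull-scalars) (⊕⊕-symmetric-hollow path hollow symmetric)
  where
  inner : Fin m → Fin m → Bool
  inner i k = lookup (whiten ε i) k ∧ (not (lookup σ k) ∧ x (whiten (whiten ε i) k) σ)
  path : Fin m → Fin m → Bool
  path i k = lookup ε i ∧ (not (lookup σ i) ∧ inner i k)
  pull-scalars : ∀ i → lookup ε i ∧ del i (dRep x (whiten ε i)) σ ≡ ⊕ (path i)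
  pull-scalars i = trans
    (cong (lookup ε i ∧_) (∧-distribˡ-⊕ (not (lookup σ i)) (inner i)))
    (∧-distribˡ-⊕ (lookup ε i) (λ k → not (lookup σ i) ∧ inner i k))
  hollow : ∀ i → path i i ≡ false
  hollow i rewrite lookup∘update i ε false =
    trans (cong (lookup ε i ∧_) (∧-zeroʳ (not (lookup σ i)))) (∧-zeroʳ (lookup ε i))
  symmetric : ∀ i k → path i k ≡ path k i
  symmetric i k with i ≟ k
  ... | yes refl = refl
  ... | no i≢k
    rewrite lookup∘update′ (i≢k ∘ sym) ε false | lookup∘update′ i≢k ε false
    = trans (∧-swap-pairs εᵢ σ∌i εₖ σ∌k (x (whiten (whiten ε i) k) σ))
            (cong (λ ε′ → εₖ ∧ (σ∌k ∧ (εᵢ ∧ (σ∌i ∧ x ε′ σ)))) ([]≔-commutes ε i k i≢k))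
    where
    εᵢ εₖ σ∌i σ∌k : Bool
    εᵢ = lookup ε i
    εₖ = lookup ε k
    σ∌i = not (lookup σ i)
    σ∌k = not (lookup σ k)

proposition6p2 : ∀ {m : ℕ} (X : SimplicialComplex m) → Connected X →
      (∀ (ε : Colouring m) (i : Fin m) → lookup ε i ≡ false → ∀ x →
          IsChain X x → IsCycle X ε x → IsCycle X (blacken ε i) (del i x))
    × (∀ (ε : Colouring m) (i : Fin m) → lookup ε i ≡ false → ∀ x y →
          IsChain X x → IsCycle X ε x → IsChain X y → IsCycle X ε y →
          Homologous X ε x y → Homologous X (blacken ε i) (del i x) (del i y))
    × (∀ (ε : Colouring m) (i : Fin m) → lookup ε i ≡ false → ∀ x (p w : ℕ) →
          IsChain X x → IsCycle X ε x → Homogeneous ε p w x →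
          Homogeneous (blacken ε i) p w (del i x))
    × (∀ (j : ℕ) (x : Colouring m → Chain m) → IsCddRep X j x →
          IsCddRep X (suc j) (dRep x))
    × (∀ (j : ℕ) (x : Colouring m → Chain m) → IsCddRep X j x →
          ∀ (ε : Colouring m) → ∣ ε ∣ ≡ suc (suc j) →
          Homologous X ε (dRep (dRep x) ε) zeroC)
proposition6p2 X _ =
    (λ ε i εᵢ x _ → del-isCycle X ε i εᵢ x)
  , (λ ε i εᵢ x y _ _ _ _ → del-homologous X ε i εᵢ)
  , (λ ε i _ x p w _ _ → del-homogeneous ε i p w x)
  , dRep-isCddRep X
  , λ j x _ ε _ → vanishing⇒homologous-zeroC X ε (dRep-dRep≡false x ε)
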